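{- Let $n$ be a positive integer and let $F_n(x):=2\left(T_n\left(\frac{x}{2}+1\right)-1\right)$, where $T_n$ is the Chebyshev polynomial of the first kind. For $j=1,\dots,n$ let $\alpha_j$ be the coefficient of $x^j$ in $F_n(x)$. Then the sequence $\{\alpha_j\}_{j=1,\dots,n}$ is log-concave, i.e. $\alpha_j^2\ge\alpha_{j-1}\alpha_{j+1}$ for all $j=2,\dots,n-1$. In particular it is unimodal: there exists $j'\in\{1,\dots,n\}$ such that $\alpha_1\le\cdots\le\alpha_{j'-1}\le\alpha_{j'}\ge\alpha_{j'+1}\ge\cdots\ge\alpha_n$.
   Context: The Chebyshev polynomial of the first kind $T_n(x)$ is the polynomial with $T_n(\cos\theta)=\cos(n\theta)$ for all real $\theta$. (Equivalently, $F_n(x)=F_n(x,1)$ where $F_n(a,b)$ is the weighted sum of rooted spanning forests of the cycle with $n$ pendant edges with pendant-edge weight $a$ and cycle-edge weight $b$.) -}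

module Defs where

open import Data.Nat using (ℕ; zero; suc)
open import Data.List using (List; []; _∷_)
open import Data.Rational using (ℚ; 0ℚ; 1ℚ; ½; _+_; _*_; -_)

-- Univariate polynomials over ℚ as coefficient lists, lowest degree first.
-- (Trailing zeros allowed; only coefficients matter.)
Poly : Set
Poly = List ℚ

coeff : Poly → ℕ → ℚ
coeff []       _       = 0ℚ
coeff (a ∷ p)  zero    = a
coeff (a ∷ p)  (suc j) = coeff p j

infixl 6 _⊕_
_⊕_ : Poly → Poly → Poly
[]      ⊕ q       = q
p       ⊕ []      = p
(a ∷ p) ⊕ (b ∷ q) = (a + b) ∷ (p ⊕ q)

_·_ : ℚ → Poly → Poly
c · []      = []
c · (a ∷ p) = (c * a) ∷ (c · p)

X* : Poly → Poly
X* p = 0ℚ ∷ p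

infixl 7 _⊗_
_⊗_ : Poly → Poly → Poly
[]      ⊗ q = []
(a ∷ p) ⊗ q = (a · q) ⊕ X* (p ⊗ q)

constP : ℚ → Poly
constP c = c ∷ []

compose : Poly → Poly → Poly
compose []      q = []
compose (a ∷ p) q = constP a ⊕ (q ⊗ compose p q)

-- Chebyshev polynomials of the first kind, via the standard recurrence
-- T₀ = 1, T₁ = x, T_{n+2} = 2x T_{n+1} − T_n
-- (equivalently the unique polynomials with T_n(cos θ) = cos(nθ)).
cheb : ℕ → Poly
cheb zero          = 1ℚ ∷ []
cheb (suc zero)    = 0ℚ ∷ 1ℚ ∷ []
cheb (suc (suc n)) = X* ((1ℚ + 1ℚ) · cheb (suc n)) ⊕ ((- 1ℚ) · cheb n)

F : ℕ → Poly
F n = (1ℚ + 1ℚ) · (compose (cheb n) (1ℚ ∷ ½ ∷ []) ⊕ constP (- 1ℚ))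

α : ℕ → ℕ → ℚ
α n j = coeff (F n) j

-- The coefficient of xʲ in 2 Tₙ(1 + x/2) is τ(n, j) = C(n+j, 2j) + C(n+j−1, 2j): on these numbers the
-- Chebyshev recurrence T_{n+2} = (2 + x) T_{n+1} − Tₙ is two applications of Pascal's rule.  So αⱼ = τ(n, j)
-- for j ≥ 1, and the absorption identities for binomial coefficients give
--   τ(n, j+1) · (2j+2)(2j+1) = τ(n, j) · (n+j)(n−j).
-- The ratio (n+j)(n−j) / ((2j+2)(2j+1)) decreases in j.  A positive sequence with decreasing ratios is
-- log-concave, and it is unimodal with its peak at the first index where the ratio drops to at most 1.
module Submission where

module Binomial where
  open import Data.Nat
  open import Data.Nat.Properties
  open import Data.Nat.Combinatorics
  open import Data.Nat.Tactic.RingSolver using (solve-∀)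
  open import Relation.Binary.PropositionalEquality
  open import Relation.Nullary using (Dec; yes; no)

  [n+1]C[k+1]*[k+1]≡nCk*[n+1] : ∀ n k → (suc n C suc k) * suc k ≡ (n C k) * suc n
  [n+1]C[k+1]*[k+1]≡nCk*[n+1] zero    zero    = refl
  [n+1]C[k+1]*[k+1]≡nCk*[n+1] zero    (suc k) =
    cong₂ _*_ (k>n⇒nCk≡0 {1} {suc (suc k)} (s<s (s<s z≤n))) (k>n⇒nCk≡0 {0} {suc k} (s≤s z≤n))
  [n+1]C[k+1]*[k+1]≡nCk*[n+1] (suc n) zero    =
    trans (*-identityʳ (suc (suc n) C 1)) (trans (nC1≡n (suc (suc n))) (sym (*-identityˡ (suc (suc n)))))
  [n+1]C[k+1]*[k+1]≡nCk*[n+1] (suc n) (suc k) = begin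
    (suc (suc n) C suc (suc k)) * suc (suc k)
      ≡⟨ cong (_* suc (suc k)) (nCk+nC[k+1]≡[n+1]C[k+1] (suc n) (suc k)) ⟨
    (a + b) * suc (suc k)
      ≡⟨ regroup a b k ⟩
    a * suc k + b * suc (suc k) + a
      ≡⟨ cong (_+ a) (cong₂ _+_ ([n+1]C[k+1]*[k+1]≡nCk*[n+1] n k) ([n+1]C[k+1]*[k+1]≡nCk*[n+1] n (suc k))) ⟩
    (n C k) * suc n + (n C suc k) * suc n + a
      ≡⟨ cong (_+ a) (*-distribʳ-+ (suc n) (n C k) (n C suc k)) ⟨
    (n C k + n C suc k) * suc n + a
      ≡⟨ cong (λ x → x * suc n + a) (nCk+nC[k+1]≡[n+1]C[k+1] n k) ⟩
    a * suc n + a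
      ≡⟨ +-comm (a * suc n) a ⟩
    a + a * suc n
      ≡⟨ *-suc a (suc n) ⟨
    a * suc (suc n) ∎
    where
    open ≡-Reasoning
    a = suc n C suc k
    b = suc n C suc (suc k)
    regroup : ∀ a b k → (a + b) * suc (suc k) ≡ a * suc k + b * suc (suc k) + a
    regroup = solve-∀

  nC[k+1]*[k+1]≡nCk*[n∸k] : ∀ n k → (n C suc k) * suc k ≡ (n C k) * (n ∸ k)
  nC[k+1]*[k+1]≡nCk*[n∸k] n k = +-cancelˡ-≡ ((n C k) * suc k) _ _ (begin
    (n C k) * suc k + (n C suc k) * suc k ≡⟨ *-distribʳ-+ (suc k) (n C k) (n C suc k) ⟨
    (n C k + n C suc k) * suc k           ≡⟨ cong (_* suc k) (nCk+nC[k+1]≡[n+1]C[k+1] n k) ⟩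
    (suc n C suc k) * suc k               ≡⟨ [n+1]C[k+1]*[k+1]≡nCk*[n+1] n k ⟩
    (n C k) * suc n                       ≡⟨ split (k ≤? n) ⟩
    (n C k) * suc k + (n C k) * (n ∸ k)   ∎)
    where
    open ≡-Reasoning
    split : Dec (k ≤ n) → (n C k) * suc n ≡ (n C k) * suc k + (n C k) * (n ∸ k)
    split (yes k≤n) = trans (cong (λ m → (n C k) * suc m) (sym (m+[n∸m]≡n k≤n))) (*-distribˡ-+ (n C k) (suc k) (n ∸ k))
    split (no  k≰n) rewrite k>n⇒nCk≡0 (≰⇒> k≰n) = refl

  C-second-difference : ∀ m r → suc (suc m) C suc (suc r) + m C suc (suc r) ≡
                                (suc m C suc (suc r) + suc m C suc (suc r)) + m C r
  C-second-difference m r = begin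
    suc (suc m) C suc (suc r) + m C suc (suc r)
      ≡⟨ cong (_+ m C suc (suc r)) (nCk+nC[k+1]≡[n+1]C[k+1] (suc m) (suc r)) ⟨
    (suc m C suc r + x) + m C suc (suc r)
      ≡⟨ cong (λ y → (y + x) + m C suc (suc r)) (nCk+nC[k+1]≡[n+1]C[k+1] m r) ⟨
    ((m C r + m C suc r) + x) + m C suc (suc r)
      ≡⟨ shuffle (m C r) (m C suc r) x (m C suc (suc r)) ⟩
    (x + (m C suc r + m C suc (suc r))) + m C r
      ≡⟨ cong (λ y → (x + y) + m C r) (nCk+nC[k+1]≡[n+1]C[k+1] m (suc r)) ⟩
    (x + x) + m C r ∎
    where
    open ≡-Reasoning
    x = suc m C suc (suc r)
    shuffle : ∀ a b c d → ((a + b) + c) + d ≡ (c + (b + d)) + a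
    shuffle = solve-∀

module RatioSequences where
  open import Data.Nat
  open import Data.Nat.Properties
  open import Data.Nat.Tactic.RingSolver using (solve-∀)
  open import Data.Product using (∃-syntax; _×_; _,_)
  open import Relation.Binary.PropositionalEquality
  open import Relation.Nullary using (¬_; yes; no)
  open import Relation.Unary using (Decidable)

  ratio≤1⇒≤ : ∀ {a₀ a₁ u v} .{{_ : NonZero v}} → a₁ * v ≡ a₀ * u → u ≤ v → a₁ ≤ a₀
  ratio≤1⇒≤ {a₀} {a₁} {u} {v} eq u≤v = *-cancelʳ-≤ a₁ a₀ v (begin
    a₁ * v   ≡⟨ eq ⟩
    a₀ * u   ≤⟨ *-monoʳ-≤ a₀ u≤v ⟩
    a₀ * v   ∎)
    where open ≤-Reasoning

  ratio≥1⇒≥ : ∀ {a₀ a₁ u v} .{{_ : NonZero v}} → a₁ * v ≡ a₀ * u → v ≤ u → a₀ ≤ a₁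
  ratio≥1⇒≥ {a₀} {a₁} {u} {v} eq v≤u = *-cancelʳ-≤ a₀ a₁ v (begin
    a₀ * v   ≤⟨ *-monoʳ-≤ a₀ v≤u ⟩
    a₀ * u   ≡⟨ eq ⟨
    a₁ * v   ∎)
    where open ≤-Reasoning

  ratio-antitone⇒logConcave : ∀ a₀ a₁ a₂ {u₀ u₁ v₀ v₁} .{{_ : NonZero (v₁ * u₀)}} →
    a₁ * v₀ ≡ a₀ * u₀ → a₂ * v₁ ≡ a₁ * u₁ → v₀ ≤ v₁ → u₁ ≤ u₀ → a₀ * a₂ ≤ a₁ * a₁
  ratio-antitone⇒logConcave a₀ a₁ a₂ {u₀} {u₁} {v₀} {v₁} eq₀ eq₁ v₀≤v₁ u₁≤u₀ =
    *-cancelʳ-≤ (a₀ * a₂) (a₁ * a₁) (v₁ * u₀) (begin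
      (a₀ * a₂) * (v₁ * u₀)   ≡⟨ regroup a₀ a₂ v₁ u₀ ⟩
      (a₀ * u₀) * (a₂ * v₁)   ≡⟨ cong₂ _*_ (sym eq₀) eq₁ ⟩
      (a₁ * v₀) * (a₁ * u₁)   ≡⟨ regroup′ a₁ v₀ u₁ ⟩
      (a₁ * a₁) * (v₀ * u₁)   ≤⟨ *-monoʳ-≤ (a₁ * a₁) (*-mono-≤ v₀≤v₁ u₁≤u₀) ⟩
      (a₁ * a₁) * (v₁ * u₀)   ∎)
    where
    open ≤-Reasoning
    regroup : ∀ a b c d → (a * b) * (c * d) ≡ (a * d) * (b * c)
    regroup = solve-∀
    regroup′ : ∀ a b c → (a * b) * (a * c) ≡ (a * a) * (b * c)
    regroup′ = solve-∀

  module UpwardClosed {P : ℕ → Set} (P? : Decidable P) (P-suc : ∀ {i} → P i → P (suc i)) where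

    P-mono : ∀ {i j} → i ≤ j → P i → P j
    P-mono i≤j = go (≤⇒≤′ i≤j)
      where
      go : ∀ {i j} → i ≤′ j → P i → P j
      go ≤′-refl       p = p
      go (≤′-step i≤j) p = P-suc (go i≤j p)

    least : ∀ {n} → P n → ∃[ j ] (j ≤ n × P j × (∀ {i} → i < j → ¬ P i))
    least {zero}  p = 0 , z≤n , p , λ ()
    least {suc n} p with P? n
    ... | yes q = let j , j≤n , pj , below = least q in j , m≤n⇒m≤1+n j≤n , pj , below
    ... | no ¬q = suc n , ≤-refl , p , λ i<1+n pi → ¬q (P-mono (≤-pred i<1+n) pi)

  module MonotoneRatio {a u v : ℕ → ℕ}
    (u-antitone : ∀ i → u (suc i) ≤ u i) (v-mono : ∀ i → v i ≤ v (suc i)) (v≢0 : ∀ i → NonZero (v i)) where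

    RatioBelow : ℕ → Set
    RatioBelow n = ∀ {i} → 1 ≤ i → i < n → a (suc i) * v i ≡ a i * u i

    logConcave : ∀ {n j} → RatioBelow n → (∀ {i} → i < n → NonZero (u i)) →
                 2 ≤ j → j < n → a (j ∸ 1) * a (suc j) ≤ a j * a j
    logConcave {j = suc zero}    _     _   (s≤s ()) _
    logConcave {j = suc (suc k)} ratio u≢0 _        j<n =
      ratio-antitone⇒logConcave (a (suc k)) (a (suc (suc k))) (a (suc (suc (suc k))))
        {{m*n≢0 _ _ {{v≢0 (suc (suc k))}} {{u≢0 i<n}}}}
        (ratio (s≤s z≤n) i<n) (ratio (s≤s z≤n) j<n) (v-mono (suc k)) (u-antitone (suc k))
      where
      i<n = <-trans (n<1+n (suc k)) j<n

    -- Shifted by one so that `least` starts at index 1: Descends i is about the step from a (i+1) to a (i+2).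
    private
      Descends : ℕ → Set
      Descends i = u (suc i) ≤ v (suc i)

    open UpwardClosed {Descends} (λ i → u (suc i) ≤? v (suc i))
      (λ {i} d → ≤-trans (u-antitone (suc i)) (≤-trans d (v-mono (suc i))))

    unimodal : ∀ {n} → RatioBelow n → 1 ≤ n → u n ≤ v n →
               ∃[ j′ ] (1 ≤ j′ × j′ ≤ n
                 × (∀ i → 1 ≤ i → i < j′ → a i ≤ a (suc i))
                 × (∀ i → j′ ≤ i → i < n → a (suc i) ≤ a i))
    unimodal {suc m} ratio _ uₙ≤vₙ with least uₙ≤vₙ
    ... | j , j≤m , descends-at-j , ascends-below-j = suc j , s≤s z≤n , s≤s j≤m , ascending , descending
      where
      ascending : ∀ i → 1 ≤ i → i < suc j → a i ≤ a (suc i)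
      ascending (suc i) _ (s≤s i<j) =
        ratio≥1⇒≥ {{v≢0 (suc i)}} (ratio (s≤s z≤n) (s≤s (<-≤-trans i<j j≤m))) (<⇒≤ (≰⇒> (ascends-below-j i<j)))
      descending : ∀ i → suc j ≤ i → i < suc m → a (suc i) ≤ a i
      descending (suc i) (s≤s j≤i) i<n =
        ratio≤1⇒≤ {{v≢0 (suc i)}} (ratio (s≤s z≤n) i<n) (P-mono j≤i descends-at-j)

module ChebyshevNumbers where
  open import Data.Nat
  open import Data.Nat.Properties
  open import Data.Nat.Combinatorics
  open import Data.Nat.Tactic.RingSolver using (solve-∀)
  open import Data.Product using (∃-syntax; _×_; _,_)
  open import Relation.Binary.PropositionalEquality
  open import Relation.Nullary using (yes; no)
  open Binomial
  open RatioSequences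

  B : ℕ → ℕ → ℕ
  B n j = (n + j) C (j + j)

  B-rec : ∀ n k → B (suc (suc n)) (suc k) + B n (suc k) ≡ (B (suc n) (suc k) + B (suc n) (suc k)) + B (suc n) k
  B-rec n k rewrite +-suc k k | +-suc n k = C-second-difference (suc (n + k)) (k + k)

  B0[k+1]≡0 : ∀ k → B 0 (suc k) ≡ 0
  B0[k+1]≡0 k = k>n⇒nCk≡0 (s≤s (m≤n+m (suc k) k))

  B1[k+1]≡B0k : ∀ k → B 1 (suc k) ≡ B 0 k
  B1[k+1]≡B0k zero    = refl
  B1[k+1]≡B0k (suc k) = trans (k>n⇒nCk≡0 (s≤s (s≤s (m≤n+m (suc (suc k)) k)))) (sym (B0[k+1]≡0 k))

  -- B-rec at n = −1, where B (−1) is read as B 0 (the truncation n ∸ 1 in τ below).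
  B-rec₋₁ : ∀ k → B 1 (suc k) + B 0 (suc k) ≡ (B 0 (suc k) + B 0 (suc k)) + B 0 k
  B-rec₋₁ k = begin
    B 1 (suc k) + B 0 (suc k)               ≡⟨ cong₂ _+_ (B1[k+1]≡B0k k) (B0[k+1]≡0 k) ⟩
    B 0 k + 0                               ≡⟨ +-identityʳ (B 0 k) ⟩
    B 0 k                                   ≡⟨ cong (λ z → (z + z) + B 0 k) (B0[k+1]≡0 k) ⟨
    (B 0 (suc k) + B 0 (suc k)) + B 0 k     ∎
    where open ≡-Reasoning

  -- At n = 0 the truncated n ∸ 1 gives τ 0 j = 2 · C(j, 2j), which is still the right value for T₀ = 1.
  τ : ℕ → ℕ → ℕ
  τ n j = B n j + B (n ∸ 1) j

  add-recurrences : ∀ a b c d e f → a + c ≡ (b + b) + e → b + d ≡ (c + c) + f →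
                    (a + b) + (c + d) ≡ ((b + c) + (b + c)) + (e + f)
  add-recurrences a b c d e f p q = begin
    (a + b) + (c + d)                 ≡⟨ swap a b c d ⟩
    (a + c) + (b + d)                 ≡⟨ cong₂ _+_ p q ⟩
    ((b + b) + e) + ((c + c) + f)     ≡⟨ regroup b c e f ⟩
    ((b + c) + (b + c)) + (e + f)     ∎
    where
    open ≡-Reasoning
    swap : ∀ a b c d → (a + b) + (c + d) ≡ (a + c) + (b + d)
    swap = solve-∀
    regroup : ∀ b c e f → ((b + b) + e) + ((c + c) + f) ≡ ((b + c) + (b + c)) + (e + f)
    regroup = solve-∀

  τ-rec : ∀ n k → τ (suc (suc n)) (suc k) + τ n (suc k) ≡ (τ (suc n) (suc k) + τ (suc n) (suc k)) + τ (suc n) k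
  τ-rec zero    k = add-recurrences (B 2 (suc k)) (B 1 (suc k)) (B 0 (suc k)) (B 0 (suc k)) (B 1 k) (B 0 k)
                      (B-rec 0 k) (B-rec₋₁ k)
  τ-rec (suc n) k = add-recurrences (B (3 + n) (suc k)) (B (2 + n) (suc k)) (B (1 + n) (suc k)) (B n (suc k))
                      (B (2 + n) k) (B (1 + n) k) (B-rec (suc n) k) (B-rec n k)

  -- δ k t = C(n+j−1, 2j−1) for j = k+1 and n = j+t; τ-mul says j · τ(n, j) = n · δ k t.
  δ : ℕ → ℕ → ℕ
  δ k t = (k + suc k + t) C (k + suc k)

  τ-mul : ∀ k t → τ (suc k + t) (suc k) * (suc k + suc k) ≡ δ k t * ((suc k + t) + (suc k + t))
  τ-mul k t = begin
    (B (suc k + t) (suc k) + B (k + t) (suc k)) * suc K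
      ≡⟨ *-distribʳ-+ (suc K) (B (suc k + t) (suc k)) (B (k + t) (suc k)) ⟩
    B (suc k + t) (suc k) * suc K + B (k + t) (suc k) * suc K
      ≡⟨ cong (λ m → (suc m C suc K) * suc K + (m C suc K) * suc K) (reorder k t) ⟩
    (suc (K + t) C suc K) * suc K + ((K + t) C suc K) * suc K
      ≡⟨ cong₂ _+_ ([n+1]C[k+1]*[k+1]≡nCk*[n+1] (K + t) K) (nC[k+1]*[k+1]≡nCk*[n∸k] (K + t) K) ⟩
    δ k t * suc (K + t) + δ k t * (K + t ∸ K)
      ≡⟨ cong (λ d → δ k t * suc (K + t) + δ k t * d) (m+n∸m≡n K t) ⟩
    δ k t * suc (K + t) + δ k t * t
      ≡⟨ *-distribˡ-+ (δ k t) (suc (K + t)) t ⟨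
    δ k t * (suc (K + t) + t)
      ≡⟨ cong (δ k t *_) (double k t) ⟩
    δ k t * ((suc k + t) + (suc k + t)) ∎
    where
    open ≡-Reasoning
    K = k + suc k
    reorder : ∀ k t → k + t + suc k ≡ k + suc k + t
    reorder = solve-∀
    double : ∀ k t → suc (k + suc k + t) + t ≡ (suc k + t) + (suc k + t)
    double = solve-∀

  ratio-num : ℕ → ℕ → ℕ
  ratio-num n j = (n + j) * (n ∸ j)

  ratio-den : ℕ → ℕ
  ratio-den j = (suc j + suc j) * suc (j + j)

  δ-ratio : ∀ k s → δ (suc k) s * (suc (suc k + suc k) * (suc k + suc k)) ≡ δ k (suc s) * ratio-num (suc (suc k) + s) (suc k)
  δ-ratio k s = begin
    δ (suc k) s * (suc (suc K) * suc K)
      ≡⟨ cong₂ (λ a b → (a C b) * (suc (suc K) * suc K)) (top k s) (bottom k) ⟩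
    (suc m C suc (suc K)) * (suc (suc K) * suc K)
      ≡⟨ *-assoc (suc m C suc (suc K)) (suc (suc K)) (suc K) ⟨
    ((suc m C suc (suc K)) * suc (suc K)) * suc K
      ≡⟨ cong (_* suc K) ([n+1]C[k+1]*[k+1]≡nCk*[n+1] m (suc K)) ⟩
    ((m C suc K) * suc m) * suc K
      ≡⟨ swap (m C suc K) (suc m) (suc K) ⟩
    ((m C suc K) * suc K) * suc m
      ≡⟨ cong (_* suc m) (nC[k+1]*[k+1]≡nCk*[n∸k] m K) ⟩
    ((m C K) * (m ∸ K)) * suc m
      ≡⟨ cong (λ d → ((m C K) * d) * suc m) (m+n∸m≡n K (suc s)) ⟩
    ((m C K) * suc s) * suc m
      ≡⟨ swap′ (m C K) (suc s) (suc m) ⟩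
    (m C K) * (suc m * suc s)
      ≡⟨ cong₂ (λ a b → (m C K) * (a * b)) (sum k s) (sym (gap k s)) ⟩
    δ k (suc s) * ratio-num (suc (suc k) + s) (suc k) ∎
    where
    open ≡-Reasoning
    K = k + suc k
    m = K + suc s
    top : ∀ k s → suc k + suc (suc k) + s ≡ suc (k + suc k + suc s)
    top = solve-∀
    bottom : ∀ k → suc k + suc (suc k) ≡ suc (suc (k + suc k))
    bottom = solve-∀
    sum : ∀ k s → suc (k + suc k + suc s) ≡ suc (suc k) + s + suc k
    sum = solve-∀
    gap : ∀ k s → suc (suc k) + s ∸ suc k ≡ suc s
    gap k s = trans (cong (_∸ k) (sym (+-suc k s))) (m+n∸m≡n k (suc s))
    swap : ∀ a b c → (a * b) * c ≡ (a * c) * b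
    swap = solve-∀
    swap′ : ∀ a b c → (a * b) * c ≡ a * (c * b)
    swap′ = solve-∀

  -- After multiplying by 2j, τ-mul at j and j+1 turns both sides into 2n · δ(n, j) · (n+j)(n−j), using δ-ratio.
  τ-ratio : ∀ {n j} → 1 ≤ j → j < n → τ n (suc j) * ratio-den j ≡ τ n j * ratio-num n j
  τ-ratio {j = suc k} _ j<n with m≤n⇒∃[o]m+o≡n j<n
  ... | s , refl = *-cancelʳ-≡ _ _ (j + j)
    (cross-multiply (τ n (suc j)) (τ n j) (suc j + suc j) (suc (j + j)) (j + j) (δ (suc k) s) (δ k (suc s))
                    (n + n) (ratio-num n j) (τ-mul (suc k) s) τ-mul′ (δ-ratio k s))
    where
    open ≡-Reasoning
    j = suc k
    n = suc j + s
    τ-mul′ : τ n j * (j + j) ≡ δ k (suc s) * (n + n)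
    τ-mul′ = subst (λ n → τ n j * (j + j) ≡ δ k (suc s) * (n + n)) (cong suc (+-suc k s)) (τ-mul k (suc s))
    cross-multiply : ∀ x y a b c d′ d N W → x * a ≡ d′ * N → y * c ≡ d * N → d′ * (b * c) ≡ d * W →
                     (x * (a * b)) * c ≡ (y * W) * c
    cross-multiply x y a b c d′ d N W hx hy hd = begin
      (x * (a * b)) * c     ≡⟨ assoc x a b c ⟩
      (x * a) * (b * c)     ≡⟨ cong (_* (b * c)) hx ⟩
      (d′ * N) * (b * c)    ≡⟨ swap d′ N (b * c) ⟩
      (d′ * (b * c)) * N    ≡⟨ cong (_* N) hd ⟩
      (d * W) * N           ≡⟨ swap d W N ⟩
      (d * N) * W           ≡⟨ cong (_* W) hy ⟨
      (y * c) * W           ≡⟨ swap y c W ⟩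
      (y * W) * c           ∎
      where
      assoc : ∀ x a b c → (x * (a * b)) * c ≡ (x * a) * (b * c)
      assoc = solve-∀
      swap : ∀ a b c → (a * b) * c ≡ (a * c) * b
      swap = solve-∀

  ratio-den-mono : ∀ i → ratio-den i ≤ ratio-den (suc i)
  ratio-den-mono i = *-mono-≤ (+-mono-≤ (n≤1+n (suc i)) (n≤1+n (suc i))) (s≤s (+-mono-≤ (n≤1+n i) (n≤1+n i)))

  ratio-num-antitone : ∀ n i → ratio-num n (suc i) ≤ ratio-num n i
  ratio-num-antitone n i with i <? n
  ... | no  i≮n = subst (_≤ ratio-num n i) (sym vanish) z≤n
    where
    vanish : ratio-num n (suc i) ≡ 0
    vanish = trans (cong ((n + suc i) *_) (m≤n⇒m∸n≡0 (m<n⇒m<1+n (≰⇒> i≮n)))) (*-zeroʳ (n + suc i))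
  ... | yes i<n = begin
    (n + suc i) * m         ≡⟨ cong (_* m) (+-suc n i) ⟩
    m + (n + i) * m         ≤⟨ +-monoˡ-≤ ((n + i) * m) (≤-trans (m∸n≤m n (suc i)) (m≤m+n n i)) ⟩
    (n + i) + (n + i) * m   ≡⟨ *-suc (n + i) m ⟨
    (n + i) * suc m         ≡⟨ cong ((n + i) *_) (+-∸-assoc 1 i<n) ⟨
    (n + i) * (n ∸ i)       ∎
    where
    open ≤-Reasoning
    m = n ∸ suc i

  ratio-num-nonZero : ∀ {n i} → i < n → NonZero (ratio-num n i)
  ratio-num-nonZero {suc n} {i} i<n = m*n≢0 (suc n + i) (suc n ∸ i) {{_}} {{>-nonZero (m<n⇒0<n∸m i<n)}}

  module _ (n : ℕ) where
    open MonotoneRatio {τ n} {ratio-num n} {ratio-den} (ratio-num-antitone n) ratio-den-mono (λ _ → _)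

    τ-logConcave : ∀ {j} → 2 ≤ j → j < n → τ n (j ∸ 1) * τ n (suc j) ≤ τ n j * τ n j
    τ-logConcave = logConcave τ-ratio ratio-num-nonZero

    τ-unimodal : 1 ≤ n → ∃[ j′ ] (1 ≤ j′ × j′ ≤ n
                   × (∀ i → 1 ≤ i → i < j′ → τ n i ≤ τ n (suc i))
                   × (∀ i → j′ ≤ i → i < n → τ n (suc i) ≤ τ n i))
    τ-unimodal 1≤n = unimodal τ-ratio 1≤n (subst (_≤ ratio-den n) (sym ratio-num-n≡0) z≤n)
      where
      ratio-num-n≡0 : ratio-num n n ≡ 0
      ratio-num-n≡0 = trans (cong ((n + n) *_) (n∸n≡0 n)) (*-zeroʳ (n + n))

module PolynomialCoefficients where
  open import Defs
  open import Data.Nat using (zero; suc)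
  open import Data.List using ([]; _∷_)
  open import Data.Rational using (0ℚ; _+_; _*_)
  open import Data.Rational.Properties using (+-identityˡ; +-identityʳ; *-zeroʳ; *-distribˡ-+)
  open import Data.Rational.Solver using (module +-*-Solver)
  open import Relation.Binary.PropositionalEquality
  open +-*-Solver

  coeff-⊕ : ∀ p q j → coeff (p ⊕ q) j ≡ coeff p j + coeff q j
  coeff-⊕ []      q       j       = sym (+-identityˡ (coeff q j))
  coeff-⊕ (a ∷ p) []      j       = sym (+-identityʳ (coeff (a ∷ p) j))
  coeff-⊕ (a ∷ p) (b ∷ q) zero    = refl
  coeff-⊕ (a ∷ p) (b ∷ q) (suc j) = coeff-⊕ p q j

  coeff-· : ∀ c p j → coeff (c · p) j ≡ c * coeff p j
  coeff-· c []      j       = sym (*-zeroʳ c)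
  coeff-· c (a ∷ p) zero    = refl
  coeff-· c (a ∷ p) (suc j) = coeff-· c p j

  coeff-∷⊗ : ∀ a r s j → coeff ((a ∷ r) ⊗ s) j ≡ a * coeff s j + coeff (X* (r ⊗ s)) j
  coeff-∷⊗ a r s j = trans (coeff-⊕ (a · s) (X* (r ⊗ s)) j) (cong (_+ coeff (X* (r ⊗ s)) j) (coeff-· a s j))

  ⊗-additiveʳ : ∀ r s t u → (∀ j → coeff u j ≡ coeff s j + coeff t j) →
                ∀ j → coeff (r ⊗ u) j ≡ coeff (r ⊗ s) j + coeff (r ⊗ t) j
  ⊗-additiveʳ []      s t u u≡s+t j = refl
  ⊗-additiveʳ (a ∷ r) s t u u≡s+t j = begin
    coeff ((a ∷ r) ⊗ u) j
      ≡⟨ coeff-∷⊗ a r u j ⟩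
    a * coeff u j + coeff (X* (r ⊗ u)) j
      ≡⟨ cong₂ (λ x y → a * x + y) (u≡s+t j) (shifted j) ⟩
    a * (coeff s j + coeff t j) + (coeff (X* (r ⊗ s)) j + coeff (X* (r ⊗ t)) j)
      ≡⟨ solve 5 (λ a x y u v → a :* (x :+ y) :+ (u :+ v) := (a :* x :+ u) :+ (a :* y :+ v)) refl
           a (coeff s j) (coeff t j) (coeff (X* (r ⊗ s)) j) (coeff (X* (r ⊗ t)) j) ⟩
    (a * coeff s j + coeff (X* (r ⊗ s)) j) + (a * coeff t j + coeff (X* (r ⊗ t)) j)
      ≡⟨ cong₂ _+_ (coeff-∷⊗ a r s j) (coeff-∷⊗ a r t j) ⟨
    coeff ((a ∷ r) ⊗ s) j + coeff ((a ∷ r) ⊗ t) j ∎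
    where
    open ≡-Reasoning
    shifted : ∀ j → coeff (X* (r ⊗ u)) j ≡ coeff (X* (r ⊗ s)) j + coeff (X* (r ⊗ t)) j
    shifted zero    = refl
    shifted (suc j) = ⊗-additiveʳ r s t u u≡s+t j

  ⊗-homogeneousʳ : ∀ r c s u → (∀ j → coeff u j ≡ c * coeff s j) →
                   ∀ j → coeff (r ⊗ u) j ≡ c * coeff (r ⊗ s) j
  ⊗-homogeneousʳ []      c s u u≡cs j = sym (*-zeroʳ c)
  ⊗-homogeneousʳ (a ∷ r) c s u u≡cs j = begin
    coeff ((a ∷ r) ⊗ u) j
      ≡⟨ coeff-∷⊗ a r u j ⟩
    a * coeff u j + coeff (X* (r ⊗ u)) j
      ≡⟨ cong₂ (λ x y → a * x + y) (u≡cs j) (shifted j) ⟩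
    a * (c * coeff s j) + c * coeff (X* (r ⊗ s)) j
      ≡⟨ solve 4 (λ a c x y → a :* (c :* x) :+ c :* y := c :* (a :* x :+ y)) refl a c (coeff s j) (coeff (X* (r ⊗ s)) j) ⟩
    c * (a * coeff s j + coeff (X* (r ⊗ s)) j)
      ≡⟨ cong (c *_) (coeff-∷⊗ a r s j) ⟨
    c * coeff ((a ∷ r) ⊗ s) j ∎
    where
    open ≡-Reasoning
    shifted : ∀ j → coeff (X* (r ⊗ u)) j ≡ c * coeff (X* (r ⊗ s)) j
    shifted zero    = sym (*-zeroʳ c)
    shifted (suc j) = ⊗-homogeneousʳ r c s u u≡cs j

  compose-⊕ : ∀ p q r j → coeff (compose (p ⊕ q) r) j ≡ coeff (compose p r) j + coeff (compose q r) j
  compose-⊕ []      q       r j = sym (+-identityˡ (coeff (compose q r) j))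
  compose-⊕ (a ∷ p) []      r j = sym (+-identityʳ (coeff (compose (a ∷ p) r) j))
  compose-⊕ (a ∷ p) (b ∷ q) r j = begin
    coeff (constP (a + b) ⊕ r ⊗ compose (p ⊕ q) r) j
      ≡⟨ coeff-⊕ (constP (a + b)) (r ⊗ compose (p ⊕ q) r) j ⟩
    coeff (constP a ⊕ constP b) j + coeff (r ⊗ compose (p ⊕ q) r) j
      ≡⟨ cong₂ _+_ (coeff-⊕ (constP a) (constP b) j)
                   (⊗-additiveʳ r (compose p r) (compose q r) (compose (p ⊕ q) r) (compose-⊕ p q r) j) ⟩
    (α₀ + β₀) + (α₁ + β₁)
      ≡⟨ solve 4 (λ a b x y → (a :+ b) :+ (x :+ y) := (a :+ x) :+ (b :+ y)) refl α₀ β₀ α₁ β₁ ⟩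
    (α₀ + α₁) + (β₀ + β₁)
      ≡⟨ cong₂ _+_ (coeff-⊕ (constP a) (r ⊗ compose p r) j) (coeff-⊕ (constP b) (r ⊗ compose q r) j) ⟨
    coeff (compose (a ∷ p) r) j + coeff (compose (b ∷ q) r) j ∎
    where
    open ≡-Reasoning
    α₀ = coeff (constP a) j
    β₀ = coeff (constP b) j
    α₁ = coeff (r ⊗ compose p r) j
    β₁ = coeff (r ⊗ compose q r) j

  compose-· : ∀ c p r j → coeff (compose (c · p) r) j ≡ c * coeff (compose p r) j
  compose-· c []      r j = sym (*-zeroʳ c)
  compose-· c (a ∷ p) r j = begin
    coeff (c · constP a ⊕ r ⊗ compose (c · p) r) j
      ≡⟨ coeff-⊕ (c · constP a) (r ⊗ compose (c · p) r) j ⟩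
    coeff (c · constP a) j + coeff (r ⊗ compose (c · p) r) j
      ≡⟨ cong₂ _+_ (coeff-· c (constP a) j)
                   (⊗-homogeneousʳ r c (compose p r) (compose (c · p) r) (compose-· c p r) j) ⟩
    c * coeff (constP a) j + c * coeff (r ⊗ compose p r) j
      ≡⟨ *-distribˡ-+ c (coeff (constP a) j) (coeff (r ⊗ compose p r) j) ⟨
    c * (coeff (constP a) j + coeff (r ⊗ compose p r) j)
      ≡⟨ cong (c *_) (coeff-⊕ (constP a) (r ⊗ compose p r) j) ⟨
    c * coeff (compose (a ∷ p) r) j ∎
    where open ≡-Reasoning

  coeff-constP-0 : ∀ j → coeff (constP 0ℚ) j ≡ 0ℚ
  coeff-constP-0 zero    = refl
  coeff-constP-0 (suc j) = refl

  compose-X* : ∀ p r j → coeff (compose (X* p) r) j ≡ coeff (r ⊗ compose p r) j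
  compose-X* p r j = trans (coeff-⊕ (constP 0ℚ) (r ⊗ compose p r) j)
                           (trans (cong (_+ coeff (r ⊗ compose p r) j) (coeff-constP-0 j)) (+-identityˡ _))

  coeff-linear⊗ : ∀ a b q j → coeff ((a ∷ b ∷ []) ⊗ q) j ≡ a * coeff q j + b * coeff (X* q) j
  coeff-linear⊗ a b q zero    = trans (coeff-∷⊗ a (b ∷ []) q 0) (cong (a * coeff q 0 +_) (sym (*-zeroʳ b)))
  coeff-linear⊗ a b q (suc j) = trans (coeff-∷⊗ a (b ∷ []) q (suc j))
    (cong (a * coeff q (suc j) +_) (trans (coeff-∷⊗ b [] q j)
      (trans (cong (b * coeff q j +_) (coeff-constP-0 j)) (+-identityʳ (b * coeff q j)))))

module ShiftedChebyshev where
  open import Defs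
  open import Data.Nat as ℕ using (ℕ; zero; suc)
  import Data.Nat.Properties as ℕ
  open import Data.List using ([]; _∷_)
  open import Data.Rational using (ℚ; 0ℚ; 1ℚ; ½; _+_; _*_; -_; _≤_)
  open import Data.Rational.Properties
    using (+-*-commutativeRing; +-mono-≤; +-monoʳ-≤; ≤-refl; nonNegative⁻¹; +-identityʳ; module ≤-Reasoning)
  open import Data.Rational.Solver using (module +-*-Solver)
  open import Algebra.Bundles using (CommutativeRing)
  open import Algebra.Properties.Semiring.Mult (CommutativeRing.semiring +-*-commutativeRing)
    using (_×_; ×-homo-+; ×1-homo-*)
  open import Data.Product using (_,_)
  open import Relation.Binary.PropositionalEquality
  open +-*-Solver
  open PolynomialCoefficients
  open ChebyshevNumbers using (τ; τ-rec; B0[k+1]≡0; B1[k+1]≡B0k)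

  embed : ℕ → ℚ
  embed n = n × 1ℚ

  embed-+ : ∀ m n → embed (m ℕ.+ n) ≡ embed m + embed n
  embed-+ = ×-homo-+ 1ℚ

  embed-* : ∀ m n → embed (m ℕ.* n) ≡ embed m * embed n
  embed-* = ×1-homo-*

  embed-nonNeg : ∀ n → 0ℚ ≤ embed n
  embed-nonNeg zero    = ≤-refl
  embed-nonNeg (suc n) = +-mono-≤ (nonNegative⁻¹ 1ℚ) (embed-nonNeg n)

  embed-mono-≤ : ∀ {m n} → m ℕ.≤ n → embed m ≤ embed n
  embed-mono-≤ {m} m≤n with ℕ.m≤n⇒∃[o]m+o≡n m≤n
  ... | d , refl = begin
    embed m             ≡⟨ +-identityʳ (embed m) ⟨
    embed m + 0ℚ        ≤⟨ +-monoʳ-≤ (embed m) (embed-nonNeg d) ⟩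
    embed m + embed d   ≡⟨ embed-+ m d ⟨
    embed (m ℕ.+ d)     ∎
    where open ≤-Reasoning

  two : ℚ
  two = 1ℚ + 1ℚ

  T[1+x/2] : ℕ → Poly
  T[1+x/2] n = compose (cheb n) (1ℚ ∷ ½ ∷ [])

  T[1+x/2]-rec : ∀ n j → coeff (T[1+x/2] (suc (suc n))) j ≡
    two * (1ℚ * coeff (T[1+x/2] (suc n)) j + ½ * coeff (X* (T[1+x/2] (suc n))) j) + (- 1ℚ) * coeff (T[1+x/2] n) j
  T[1+x/2]-rec n j = begin
    coeff (compose (X* (two · cheb (suc n)) ⊕ (- 1ℚ) · cheb n) L) j
      ≡⟨ compose-⊕ (X* (two · cheb (suc n))) ((- 1ℚ) · cheb n) L j ⟩
    coeff (compose (X* (two · cheb (suc n))) L) j + coeff (compose ((- 1ℚ) · cheb n) L) j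
      ≡⟨ cong₂ _+_ (trans (compose-X* (two · cheb (suc n)) L j)
                          (⊗-homogeneousʳ L two (T[1+x/2] (suc n)) (compose (two · cheb (suc n)) L)
                                          (compose-· two (cheb (suc n)) L) j))
                   (compose-· (- 1ℚ) (cheb n) L j) ⟩
    two * coeff (L ⊗ T[1+x/2] (suc n)) j + (- 1ℚ) * coeff (T[1+x/2] n) j
      ≡⟨ cong (λ x → two * x + (- 1ℚ) * coeff (T[1+x/2] n) j) (coeff-linear⊗ 1ℚ ½ (T[1+x/2] (suc n)) j) ⟩
    two * (1ℚ * coeff (T[1+x/2] (suc n)) j + ½ * coeff (X* (T[1+x/2] (suc n))) j) + (- 1ℚ) * coeff (T[1+x/2] n) j ∎
    where
    open ≡-Reasoning
    L = 1ℚ ∷ ½ ∷ []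

  T[1+x/2]-coeff : ∀ n j → coeff (T[1+x/2] n) j ≡ ½ * embed (τ n j)
  T[1+x/2]-coeff zero          zero                = refl
  T[1+x/2]-coeff zero          (suc zero)          = refl
  T[1+x/2]-coeff zero          (suc (suc k))       = cong (λ b → ½ * embed (b ℕ.+ b)) (sym (B0[k+1]≡0 (suc k)))
  T[1+x/2]-coeff (suc zero)    zero                = refl
  T[1+x/2]-coeff (suc zero)    (suc zero)          = refl
  T[1+x/2]-coeff (suc zero)    (suc (suc zero))    = refl
  T[1+x/2]-coeff (suc zero)    (suc (suc (suc k))) =
    cong₂ (λ b c → ½ * embed (b ℕ.+ c)) (sym (trans (B1[k+1]≡B0k (suc (suc k))) (B0[k+1]≡0 (suc k))))
                                        (sym (B0[k+1]≡0 (suc (suc k))))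
  T[1+x/2]-coeff (suc (suc n)) zero                = trans (T[1+x/2]-rec n 0)
    (cong₂ (λ x y → two * (1ℚ * x + ½ * 0ℚ) + (- 1ℚ) * y) (T[1+x/2]-coeff (suc n) 0) (T[1+x/2]-coeff n 0))
  T[1+x/2]-coeff (suc (suc n)) (suc k)             = begin
    coeff (T[1+x/2] (suc (suc n))) (suc k)
      ≡⟨ T[1+x/2]-rec n (suc k) ⟩
    two * (1ℚ * coeff (T[1+x/2] (suc n)) (suc k) + ½ * coeff (T[1+x/2] (suc n)) k) + (- 1ℚ) * coeff (T[1+x/2] n) (suc k)
      ≡⟨ cong₂ (λ x y → two * (1ℚ * x + ½ * y) + (- 1ℚ) * coeff (T[1+x/2] n) (suc k))
               (T[1+x/2]-coeff (suc n) (suc k)) (T[1+x/2]-coeff (suc n) k) ⟩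
    two * (1ℚ * (½ * e₁) + ½ * (½ * e₁′)) + (- 1ℚ) * coeff (T[1+x/2] n) (suc k)
      ≡⟨ cong (λ z → two * (1ℚ * (½ * e₁) + ½ * (½ * e₁′)) + (- 1ℚ) * z) (T[1+x/2]-coeff n (suc k)) ⟩
    two * (1ℚ * (½ * e₁) + ½ * (½ * e₁′)) + (- 1ℚ) * (½ * e₀)
      ≡⟨ solve 3 (λ x y z → con two :* (con 1ℚ :* (con ½ :* x) :+ con ½ :* (con ½ :* y)) :+ con (- 1ℚ) :* (con ½ :* z)
                            := con ½ :* (((x :+ x) :+ y) :+ :- z)) refl e₁ e₁′ e₀ ⟩
    ½ * (((e₁ + e₁) + e₁′) + - e₀)
      ≡⟨ cong (½ *_) e₂≡ ⟨
    ½ * e₂ ∎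
    where
    open ≡-Reasoning
    e₂ = embed (τ (suc (suc n)) (suc k))
    e₁ = embed (τ (suc n) (suc k))
    e₁′ = embed (τ (suc n) k)
    e₀ = embed (τ n (suc k))
    e₂+e₀≡ : e₂ + e₀ ≡ (e₁ + e₁) + e₁′
    e₂+e₀≡ = begin
      e₂ + e₀
        ≡⟨ embed-+ (τ (suc (suc n)) (suc k)) (τ n (suc k)) ⟨
      embed (τ (suc (suc n)) (suc k) ℕ.+ τ n (suc k))
        ≡⟨ cong embed (τ-rec n k) ⟩
      embed ((τ (suc n) (suc k) ℕ.+ τ (suc n) (suc k)) ℕ.+ τ (suc n) k)
        ≡⟨ embed-+ (τ (suc n) (suc k) ℕ.+ τ (suc n) (suc k)) (τ (suc n) k) ⟩
      embed (τ (suc n) (suc k) ℕ.+ τ (suc n) (suc k)) + e₁′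
        ≡⟨ cong (_+ e₁′) (embed-+ (τ (suc n) (suc k)) (τ (suc n) (suc k))) ⟩
      (e₁ + e₁) + e₁′ ∎
    e₂≡ : e₂ ≡ ((e₁ + e₁) + e₁′) + - e₀
    e₂≡ = trans (solve 2 (λ x y → x := (x :+ y) :+ :- y) refl e₂ e₀) (cong (_+ - e₀) e₂+e₀≡)

  α≡τ : ∀ n k → α n (suc k) ≡ embed (τ n (suc k))
  α≡τ n k = begin
    coeff (two · (T[1+x/2] n ⊕ constP (- 1ℚ))) (suc k)   ≡⟨ coeff-· two (T[1+x/2] n ⊕ constP (- 1ℚ)) (suc k) ⟩
    two * coeff (T[1+x/2] n ⊕ constP (- 1ℚ)) (suc k)     ≡⟨ cong (two *_) (coeff-⊕ (T[1+x/2] n) (constP (- 1ℚ)) (suc k)) ⟩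
    two * (coeff (T[1+x/2] n) (suc k) + 0ℚ)              ≡⟨ cong (λ x → two * (x + 0ℚ)) (T[1+x/2]-coeff n (suc k)) ⟩
    two * (½ * e + 0ℚ)                                   ≡⟨ solve 1 (λ x → con two :* (con ½ :* x :+ con 0ℚ) := x) refl e ⟩
    e                                                    ∎
    where
    open ≡-Reasoning
    e = embed (τ n (suc k))

  α-mono-≤ : ∀ n {i j} → 1 ℕ.≤ i → 1 ℕ.≤ j → τ n i ℕ.≤ τ n j → α n i ≤ α n j
  α-mono-≤ n {suc i} {suc j} _ _ le = subst₂ _≤_ (sym (α≡τ n i)) (sym (α≡τ n j)) (embed-mono-≤ le)

  α*α-mono-≤ : ∀ n {i j k l} → 1 ℕ.≤ i → 1 ℕ.≤ j → 1 ℕ.≤ k → 1 ℕ.≤ l →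
               τ n i ℕ.* τ n j ℕ.≤ τ n k ℕ.* τ n l → α n i * α n j ≤ α n k * α n l
  α*α-mono-≤ n {suc i} {suc j} {suc k} {suc l} _ _ _ _ le =
    subst₂ _≤_ (trans (embed-* (τ n (suc i)) (τ n (suc j))) (sym (cong₂ _*_ (α≡τ n i) (α≡τ n j))))
               (trans (embed-* (τ n (suc k)) (τ n (suc l))) (sym (cong₂ _*_ (α≡τ n k) (α≡τ n l))))
               (embed-mono-≤ le)

open import Defs
open import Data.Nat using (ℕ; suc; zero; _<_; _≤_; _∸_; z≤n; s≤s)
open import Data.Nat.Properties using (≤-trans)
open import Data.Rational using (_*_) renaming (_≤_ to _≤ℚ_)
open import Data.Product using (_×_; ∃-syntax; _,_)
open ChebyshevNumbers using (τ-logConcave; τ-unimodal)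
open ShiftedChebyshev using (α-mono-≤; α*α-mono-≤)

corollary4p2 : (n : ℕ) → 1 ≤ n →
    ((j : ℕ) → 2 ≤ j → j ≤ n ∸ 1 →
      (α n (j ∸ 1) * α n (suc j)) ≤ℚ (α n j * α n j))
    × (∃[ j′ ] (1 ≤ j′ × j′ ≤ n
        × ((i : ℕ) → 1 ≤ i → i < j′ → α n i ≤ℚ α n (suc i))
        × ((i : ℕ) → j′ ≤ i → i < n → α n (suc i) ≤ℚ α n i)))
corollary4p2 (suc m) 1≤n with τ-unimodal (suc m) 1≤n
... | j′ , 1≤j′ , j′≤n , ascending , descending =
  logConcave ,
  (j′ , 1≤j′ , j′≤n ,
   (λ i 1≤i i<j′ → α-mono-≤ (suc m) 1≤i (s≤s z≤n) (ascending i 1≤i i<j′)) ,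
   (λ i j′≤i i<n → α-mono-≤ (suc m) (s≤s z≤n) (≤-trans 1≤j′ j′≤i) (descending i j′≤i i<n)))
  where
  logConcave : (j : ℕ) → 2 ≤ j → j ≤ m → (α (suc m) (j ∸ 1) * α (suc m) (suc j)) ≤ℚ (α (suc m) j * α (suc m) j)
  logConcave (suc zero)    (s≤s ()) _
  logConcave (suc (suc k)) 2≤j      j≤m =
    α*α-mono-≤ (suc m) (s≤s z≤n) (s≤s z≤n) (s≤s z≤n) (s≤s z≤n) (τ-logConcave (suc m) 2≤j (s≤s j≤m))
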